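{- Fix $\epsilon<1/40$. Let $G$ be a graph, $P=K_3\times G$, $H$ be $\epsilon$-near $P$ via bijection $\psi$, and $C$ the candidate edge graph of $H$. Let $\{u,v\}\in E(C)$ with $|\Gamma_H(u)|\ge|\Gamma_H(v)|$, and write $\psi(u)=(t_1,g_1)$, $\psi(v)=(t_2,g_2)$. Then either (1) $t_1=t_2$ and $(1-6\epsilon)\frac{|\Gamma_H(u)|}{4}\le|I_G(g_1,g_2)|\le(1+8\epsilon)\frac{|\Gamma_H(u)|}{4}$; or (2) $t_1\ne t_2$ and $(1-6\epsilon)\frac{|\Gamma_H(u)|}{2}\le|I_G(g_1,g_2)|\le(1+8\epsilon)\frac{|\Gamma_H(u)|}{2}$.
   Context: Graphs are finite, undirected, simple, loopless. $\Gamma_X(v)$ is the neighbourhood of $v$ in $X$, $I_X(u,v)=\Gamma_X(u)\cap\Gamma_X(v)$. The tensor product $F\times G$ has vertex set $V(F)\times V(G)$, with $(f,g)$, $(f',g')$ adjacent iff $\{f,f'\}\in E(F)$ and $\{g,g'\}\in E(G)$. $K_3$ is the complete graph on $\{a,b,c\}$. $H$ is $\epsilon$-near $P=K_3\times G$ means: there is $E'\subseteq E(P)$ such that each vertex $w$ of $P$ has at most $\epsilon|\Gamma_P(w)|$ incident edges in $E'$, and a bijection $\psi:V(H)\to V(P)$ which is a graph isomorphism from $H$ onto $(V(P),E(P)\setminus E')$. The candidate edge graph $C$ has vertex set $V(H)$; distinct $u,v$ with $|\Gamma_H(u)|\ge|\Gamma_H(v)|$ are adjacent in $C$ iff (i)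 $|\Gamma_H(u)|-|\Gamma_H(v)|\le 2\epsilon|\Gamma_H(u)|$, and (ii) $(1-6\epsilon)\frac{|\Gamma_H(u)|}{2}\le|I_H(u,v)|\le\frac{1}{1-\epsilon}\cdot\frac{|\Gamma_H(u)|}{2}$. -}

module Defs where

open import Data.Nat as ℕ using (ℕ; zero; suc)
open import Data.Integer using (+_)
open import Data.Rational using (ℚ; _/_; _+_; _-_; _*_; _≤_; _<_; 1ℚ; ½)
open import Data.Fin using (Fin; zero; suc)
open import Data.Bool using (Bool; true; false; if_then_else_; _∧_; not)
open import Data.Product using (_×_; _,_; proj₁; proj₂)
open import Data.Sum using (_⊎_)
open import Relation.Binary.PropositionalEquality using (_≡_; _≢_)
open import Function.Bundles using (_⤖_; Bijection)

count : {n : ℕ} → (Fin n → Bool) → ℕ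
count {zero}  f = 0
count {suc n} f = (if f zero then 1 else 0) ℕ.+ count (λ i → f (suc i))

record Graph : Set where
  field
    n      : ℕ
    adj    : Fin n → Fin n → Bool
    sym    : ∀ x y → adj x y ≡ adj y x
    irrefl : ∀ x → adj x x ≡ false
open Graph public

deg : (X : Graph) → Fin (n X) → ℕ
deg X v = count (adj X v)

common : (X : Graph) → Fin (n X) → Fin (n X) → ℕ
common X u v = count (λ w → adj X u w ∧ adj X v w)

adjK3 : Fin 3 → Fin 3 → Bool
adjK3 zero zero = false
adjK3 (suc zero) (suc zero) = false
adjK3 (suc (suc zero)) (suc (suc zero)) = false
adjK3 _ _ = true

VP : Graph → Set
VP G = Fin 3 × Fin (n G)

adjP : (G : Graph) → VP G → VP G → Bool
adjP G (t , g) (t' , g') = adjK3 t t' ∧ adj G g g'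

countP : (G : Graph) → (VP G → Bool) → ℕ
countP G f = count (λ g → f (zero , g)) ℕ.+ count (λ g → f (suc zero , g))
               ℕ.+ count (λ g → f (suc (suc zero) , g))

degP : (G : Graph) → VP G → ℕ
degP G w = countP G (adjP G w)

ℕ→ℚ : ℕ → ℚ
ℕ→ℚ k = (+ k) / 1

-- H is ε-near P = K_3 × G via the bijection ψ : V(H) → V(P).
-- The removed edge set E' ⊆ E(P) is given by a symmetric Boolean relation rem.
record IsNear (ε : ℚ) (G H : Graph) (ψ : Fin (n H) ⤖ VP G) : Set where
  field
    rem       : VP G → VP G → Bool
    rem-sym   : ∀ w w' → rem w w' ≡ rem w' w
    rem⊆E     : ∀ w w' → rem w w' ≡ true → adjP G w w' ≡ true
    rem-deg   : ∀ w → ℕ→ℚ (countP G (rem w)) ≤ ε * ℕ→ℚ (degP G w)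
    iso       : ∀ u v → adj H u v ≡ (adjP G (Bijection.to ψ u) (Bijection.to ψ v)
                                      ∧ not (rem (Bijection.to ψ u) (Bijection.to ψ v)))

-- conditions (i),(ii) of the candidate edge graph for the ordered pair (u,v),
-- meant for |Γ_H(u)| ≥ |Γ_H(v)|.  The upper bound |I| ≤ (1/(1-ε))·|Γ(u)|/2 is
-- written multiplied out as (1-ε)·|I| ≤ |Γ(u)|/2 (1-ε > 0 as ε < 1/40).
CandCond : (ε : ℚ) (H : Graph) → Fin (n H) → Fin (n H) → Set
CandCond ε H u v =
  (ℕ→ℚ (deg H u) - ℕ→ℚ (deg H v) ≤ (ℕ→ℚ 2 * ε) * ℕ→ℚ (deg H u))
  × ((1ℚ - ℕ→ℚ 6 * ε) * (ℕ→ℚ (deg H u) * ½) ≤ ℕ→ℚ (common H u v))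
  × ((1ℚ - ε) * ℕ→ℚ (common H u v) ≤ ℕ→ℚ (deg H u) * ½)

CandAdj : (ε : ℚ) (H : Graph) → Fin (n H) → Fin (n H) → Set
CandAdj ε H u v =
  u ≢ v × ((deg H v ℕ.≤ deg H u × CandCond ε H u v)
          ⊎ (deg H u ℕ.≤ deg H v × CandCond ε H v u))

-- Transport every count along ψ to P = K₃ × G.  There the common neighbourhood of
-- (t₁, g₁) and (t₂, g₂) has c · |I_G(g₁, g₂)| elements, where c = |I_{K₃}(t₁, t₂)| is 2
-- if t₁ = t₂ and 1 otherwise.  It differs from |I_H(u, v)| only by the removed edges at
-- ψ(u) and ψ(v), whose numbers R satisfy R ≤ ε(deg_H + R), i.e. (1 - ε)R ≤ ε deg_H.
-- Hence the candidate-edge bounds on |I_H(u, v)| give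
-- (1 - 6ε)d/2 ≤ c · |I_G(g₁, g₂)| ≤ (1 + 8ε)d/2 for d = |Γ_H(u)|; divide by c.
module Submission where

open import Defs hiding (sym)
open import Algebra.Bundles using (CommutativeMonoid)
open import Data.Bool using (Bool; true; false; if_then_else_; _∧_; _∨_; not)
import Data.Bool.Properties as 𝔹
open import Data.Fin using (Fin; zero; suc; _↑ˡ_; _↑ʳ_; combine; remQuot)
open import Data.Fin.Properties using (*↔×; remQuot-combine)
open import Data.Fin.Permutation using (Permutation; _⟨$⟩ʳ_)
open import Data.Integer as ℤ using (+_)
import Data.Integer.Properties as ℤ
open import Data.Nat as ℕ using (ℕ; zero; suc; z≤n; s≤s)
import Data.Nat.Properties as ℕ
open import Data.Nat.Coprimality as Coprime using (1-coprimeTo)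
open import Data.Nat.Solver using () renaming (module +-*-Solver to ℕ-Solver)
open import Data.Product using (_×_; _,_; proj₁; proj₂)
open import Data.Rational
  using ( ℚ; mkℚ; _/_; _+_; _-_; -_; _*_; _≤_; _<_; *≤*; 0ℚ; 1ℚ; ½
        ; positive; nonNegative; nonPositive; negative)
open import Data.Rational.Properties
open import Data.Rational.Solver using () renaming (module +-*-Solver to ℚ-Solver)
open import Data.Sum using (_⊎_; inj₁; inj₂)
open import Data.Unit using (tt)
open import Function using (_∘_)
open import Function.Bundles using (_⤖_; Bijection)
open import Function.Construct.Composition using (_↔-∘_)
open import Function.Construct.Symmetry using (↔-sym)
open import Function.Properties.Bijection using (⤖⇒↔)
open import Relation.Binary.PropositionalEquality
  using (_≡_; _≢_; refl; sym; trans; cong; cong₂; subst; subst₂; module ≡-Reasoning)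
open import Relation.Nullary using (yes; no)
open import Relation.Nullary.Decidable using (toWitness)

open import Algebra.Properties.CommutativeMonoid.Sum ℕ.+-0-commutativeMonoid
  using (sum; sum-cong-≗; ∑-permute)
open import Algebra.Properties.CommutativeSemigroup ℕ.+-commutativeSemigroup
  using () renaming (interchange to +-interchange)
open import Algebra.Properties.CommutativeSemigroup
  (CommutativeMonoid.commutativeSemigroup 𝔹.∧-commutativeMonoid)
  using () renaming (interchange to ∧-interchange)

indicator : Bool → ℕ
indicator b = if b then 1 else 0

indicator-split : ∀ {x r} → (r ≡ true → x ≡ true) → indicator x ≡ indicator (x ∧ not r) ℕ.+ indicator r
indicator-split {false} {false} _   = refl
indicator-split {true}  {false} _   = refl
indicator-split {x}     {true}  r⇒x rewrite r⇒x refl = refl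

indicator-∨ : ∀ r s → indicator (r ∨ s) ℕ.≤ indicator r ℕ.+ indicator s
indicator-∨ false s = ℕ.≤-refl
indicator-∨ true  s = s≤s z≤n

indicator-kept-≤ : ∀ x r y s → indicator ((x ∧ not r) ∧ (y ∧ not s)) ℕ.≤ indicator (x ∧ y)
indicator-kept-≤ false r     y     s     = z≤n
indicator-kept-≤ true  true  y     s     = z≤n
indicator-kept-≤ true  false false s     = z≤n
indicator-kept-≤ true  false true  true  = z≤n
indicator-kept-≤ true  false true  false = ℕ.≤-refl

indicator-≤-kept+removed : ∀ x r y s →
  indicator (x ∧ y) ℕ.≤ indicator ((x ∧ not r) ∧ (y ∧ not s)) ℕ.+ indicator (r ∨ s)
indicator-≤-kept+removed false r     y     s     = z≤n
indicator-≤-kept+removed true  r     false s     = z≤n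
indicator-≤-kept+removed true  true  true  s     = ℕ.≤-refl
indicator-≤-kept+removed true  false true  true  = ℕ.≤-refl
indicator-≤-kept+removed true  false true  false = ℕ.≤-refl

count-as-sum : ∀ {k} (f : Fin k → Bool) → count f ≡ sum (indicator ∘ f)
count-as-sum {zero}  f = refl
count-as-sum {suc k} f = cong (indicator (f zero) ℕ.+_) (count-as-sum (f ∘ suc))

count-cong : ∀ {k} {f g : Fin k → Bool} → (∀ i → f i ≡ g i) → count f ≡ count g
count-cong {zero}  f≗g = refl
count-cong {suc k} f≗g = cong₂ ℕ._+_ (cong indicator (f≗g zero)) (count-cong (f≗g ∘ suc))

count-false : ∀ {k} → count {k} (λ _ → false) ≡ 0
count-false {zero}  = refl
count-false {suc k} = count-false {k}

count-mono : ∀ {k} {f g : Fin k → Bool} →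
  (∀ i → indicator (f i) ℕ.≤ indicator (g i)) → count f ℕ.≤ count g
count-mono {zero}  f≤g = z≤n
count-mono {suc k} f≤g = ℕ.+-mono-≤ (f≤g zero) (count-mono (f≤g ∘ suc))

count-+ : ∀ {k} {f g h : Fin k → Bool} →
  (∀ i → indicator (f i) ≡ indicator (g i) ℕ.+ indicator (h i)) →
  count f ≡ count g ℕ.+ count h
count-+ {zero}  f≡g+h = refl
count-+ {suc k} {f} {g} {h} f≡g+h =
  trans (cong₂ ℕ._+_ (f≡g+h zero) (count-+ (f≡g+h ∘ suc)))
    (+-interchange (indicator (g zero)) (indicator (h zero)) (count (g ∘ suc)) (count (h ∘ suc)))

count-≤-+ : ∀ {k} {f g h : Fin k → Bool} →
  (∀ i → indicator (f i) ℕ.≤ indicator (g i) ℕ.+ indicator (h i)) →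
  count f ℕ.≤ count g ℕ.+ count h
count-≤-+ {zero}  f≤g+h = z≤n
count-≤-+ {suc k} {f} {g} {h} f≤g+h =
  ℕ.≤-trans (ℕ.+-mono-≤ (f≤g+h zero) (count-≤-+ (f≤g+h ∘ suc))) (ℕ.≤-reflexive
    (+-interchange (indicator (g zero)) (indicator (h zero)) (count (g ∘ suc)) (count (h ∘ suc))))

count-∧ˡ : ∀ {k} x (f : Fin k → Bool) → count (λ i → x ∧ f i) ≡ indicator x ℕ.* count f
count-∧ˡ true  f = sym (ℕ.+-identityʳ (count f))
count-∧ˡ {k} false f = count-false {k}

count-↑ : ∀ m {k} (f : Fin (m ℕ.+ k) → Bool) →
  count f ≡ count (f ∘ (_↑ˡ k)) ℕ.+ count (f ∘ (m ↑ʳ_))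
count-↑ zero    f = refl
count-↑ (suc m) {k} f = trans (cong (indicator (f zero) ℕ.+_) (count-↑ m (f ∘ suc)))
  (sym (ℕ.+-assoc (indicator (f zero)) (count (f ∘ suc ∘ (_↑ˡ k))) (count (f ∘ suc ∘ (m ↑ʳ_)))))

count-combine : ∀ k {m} (f : Fin (k ℕ.* m) → Bool) →
  count f ≡ sum {k} (λ t → count {m} (λ j → f (combine t j)))
count-combine zero        f = refl
count-combine (suc k) {m} f = trans (count-↑ m f)
  (cong (count (f ∘ (_↑ˡ (k ℕ.* m))) ℕ.+_) (count-combine k (f ∘ (m ↑ʳ_))))

count-permute : ∀ {m k} (π : Permutation m k) (f : Fin k → Bool) →
  count (f ∘ (π ⟨$⟩ʳ_)) ≡ count f
count-permute π f = begin
  count (f ∘ (π ⟨$⟩ʳ_))         ≡⟨ count-as-sum (f ∘ (π ⟨$⟩ʳ_)) ⟩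
  sum (indicator ∘ f ∘ (π ⟨$⟩ʳ_)) ≡⟨ ∑-permute (indicator ∘ f) π ⟨
  sum (indicator ∘ f)           ≡⟨ count-as-sum f ⟨
  count f                       ∎
  where open ≡-Reasoning

countP-as-count : (G : Graph) (F : VP G → Bool) →
  countP G F ≡ count {3 ℕ.* n G} (F ∘ remQuot (n G))
countP-as-count G F = begin
  count (column zero) ℕ.+ count (column (suc zero)) ℕ.+ count (column (suc (suc zero)))
    ≡⟨ ℕ.+-assoc (count (column zero)) _ _ ⟩
  count (column zero) ℕ.+ (count (column (suc zero)) ℕ.+ count (column (suc (suc zero))))
    ≡⟨ cong (λ c → count (column zero) ℕ.+ (count (column (suc zero)) ℕ.+ c))
         (ℕ.+-identityʳ _) ⟨
  sum {3} (λ t → count (column t))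
    ≡⟨ sum-cong-≗ (λ t → count-cong (λ j → cong F (remQuot-combine t j))) ⟨
  sum {3} (λ t → count {n G} (λ j → F (remQuot (n G) (combine t j))))
    ≡⟨ count-combine 3 {n G} (F ∘ remQuot (n G)) ⟨
  count (F ∘ remQuot (n G)) ∎
  where
  open ≡-Reasoning
  column : Fin 3 → Fin (n G) → Bool
  column t j = F (t , j)

count-transport : ∀ {m} (G : Graph) (ψ : Fin m ⤖ VP G) (F : VP G → Bool) →
  count (F ∘ Bijection.to ψ) ≡ countP G F
count-transport G ψ F = begin
  count (F ∘ Bijection.to ψ)               ≡⟨ count-cong remQuot-π ⟨
  count (F ∘ remQuot (n G) ∘ (π ⟨$⟩ʳ_))  ≡⟨ count-permute π (F ∘ remQuot (n G)) ⟩
  count (F ∘ remQuot (n G))                ≡⟨ countP-as-count G F ⟨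
  countP G F                               ∎
  where
  open ≡-Reasoning
  π : Permutation _ (3 ℕ.* n G)
  π = ↔-sym *↔× ↔-∘ ⤖⇒↔ ψ
  remQuot-π : ∀ w → F (remQuot (n G) (π ⟨$⟩ʳ w)) ≡ F (Bijection.to ψ w)
  remQuot-π w = cong F (remQuot-combine (proj₁ (Bijection.to ψ w)) (proj₂ (Bijection.to ψ w)))

commonP : (G : Graph) → VP G → VP G → ℕ
commonP G w w' = countP G (λ x → adjP G w x ∧ adjP G w' x)

commonK3 : Fin 3 → Fin 3 → ℕ
commonK3 t t' = count (λ s → adjK3 t s ∧ adjK3 t' s)

commonK3-cases : ∀ t t' → (t ≡ t' × commonK3 t t' ≡ 2) ⊎ (t ≢ t' × commonK3 t t' ≡ 1)
commonK3-cases zero             zero             = inj₁ (refl , refl)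
commonK3-cases zero             (suc zero)       = inj₂ ((λ ()) , refl)
commonK3-cases zero             (suc (suc zero)) = inj₂ ((λ ()) , refl)
commonK3-cases (suc zero)       zero             = inj₂ ((λ ()) , refl)
commonK3-cases (suc zero)       (suc zero)       = inj₁ (refl , refl)
commonK3-cases (suc zero)       (suc (suc zero)) = inj₂ ((λ ()) , refl)
commonK3-cases (suc (suc zero)) zero             = inj₂ ((λ ()) , refl)
commonK3-cases (suc (suc zero)) (suc zero)       = inj₂ ((λ ()) , refl)
commonK3-cases (suc (suc zero)) (suc (suc zero)) = inj₁ (refl , refl)

countP-cong : (G : Graph) {F F′ : VP G → Bool} → (∀ x → F x ≡ F′ x) → countP G F ≡ countP G F′
countP-cong G F≗F′ = cong₂ ℕ._+_
  (cong₂ ℕ._+_ (count-cong (λ g → F≗F′ (zero , g))) (count-cong (λ g → F≗F′ (suc zero , g))))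
  (count-cong (λ g → F≗F′ (suc (suc zero) , g)))

countP-product : (G : Graph) (a : Fin 3 → Bool) (b : Fin (n G) → Bool) →
  countP G (λ (t , g) → a t ∧ b g) ≡ count a ℕ.* count b
countP-product G a b = begin
  count (λ g → a zero ∧ b g) ℕ.+ count (λ g → a (suc zero) ∧ b g)
    ℕ.+ count (λ g → a (suc (suc zero)) ∧ b g)
    ≡⟨ cong₂ ℕ._+_ (cong₂ ℕ._+_ (count-∧ˡ _ b) (count-∧ˡ _ b)) (count-∧ˡ _ b) ⟩
  x ℕ.* count b ℕ.+ y ℕ.* count b ℕ.+ z ℕ.* count b
    ≡⟨ solve 4 (λ x y z c → x :* c :+ y :* c :+ z :* c := (x :+ (y :+ (z :+ con 0))) :* c)
         refl x y z (count b) ⟩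
  count a ℕ.* count b ∎
  where
  open ≡-Reasoning
  open ℕ-Solver
  x = indicator (a zero)
  y = indicator (a (suc zero))
  z = indicator (a (suc (suc zero)))

commonP-tensor : (G : Graph) (t t' : Fin 3) (g g' : Fin (n G)) →
  commonP G (t , g) (t' , g') ≡ commonK3 t t' ℕ.* common G g g'
commonP-tensor G t t' g g' = trans (countP-cong G rearrange)
  (countP-product G (λ s → adjK3 t s ∧ adjK3 t' s) (λ h → adj G g h ∧ adj G g' h))
  where
  rearrange : ∀ x → (adjP G (t , g) x ∧ adjP G (t' , g') x)
    ≡ (adjK3 t (proj₁ x) ∧ adjK3 t' (proj₁ x)) ∧ (adj G g (proj₂ x) ∧ adj G g' (proj₂ x))
  rearrange (s , h) = ∧-interchange (adjK3 t s) (adj G g h) (adjK3 t' s) (adj G g' h)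

ℕ→ℚ≡mkℚ : ∀ k → ℕ→ℚ k ≡ mkℚ (+ k) 0 (Coprime.sym (1-coprimeTo k))
ℕ→ℚ≡mkℚ k = normalize-coprime (Coprime.sym (1-coprimeTo k))

ℕ→ℚ-+ : ∀ a b → ℕ→ℚ (a ℕ.+ b) ≡ ℕ→ℚ a + ℕ→ℚ b
ℕ→ℚ-+ a b rewrite ℕ→ℚ≡mkℚ a | ℕ→ℚ≡mkℚ b =
  cong (_/ 1) (sym (cong₂ ℤ._+_ (ℤ.*-identityʳ (+ a)) (ℤ.*-identityʳ (+ b))))

ℕ→ℚ-mono-≤ : ∀ {a b} → a ℕ.≤ b → ℕ→ℚ a ≤ ℕ→ℚ b
ℕ→ℚ-mono-≤ {a} {b} a≤b rewrite ℕ→ℚ≡mkℚ a | ℕ→ℚ≡mkℚ b =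
  *≤* (ℤ.*-monoʳ-≤-nonNeg (+ 1) (ℤ.+≤+ a≤b))

ℕ→ℚ-nonNeg : ∀ a → 0ℚ ≤ ℕ→ℚ a
ℕ→ℚ-nonNeg a = ℕ→ℚ-mono-≤ {0} {a} z≤n

ℕ→ℚ-double : ∀ a → ℕ→ℚ (2 ℕ.* a) ≡ ℕ→ℚ a + ℕ→ℚ a
ℕ→ℚ-double a = trans (cong (λ b → ℕ→ℚ (a ℕ.+ b)) (ℕ.+-identityʳ a)) (ℕ→ℚ-+ a a)

p<q⇒0<q-p : ∀ {p q} → p < q → 0ℚ < q - p
p<q⇒0<q-p {p} {q} p<q = subst (_< q - p) (+-inverseʳ p) (+-monoˡ-< (- p) p<q)

nonNeg*nonNeg : ∀ {p q} → 0ℚ ≤ p → 0ℚ ≤ q → 0ℚ ≤ p * q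
nonNeg*nonNeg {p} {q} 0≤p 0≤q =
  subst (_≤ p * q) (*-zeroʳ p) (*-monoˡ-≤-nonNeg p {{nonNegative 0≤p}} 0≤q)

[q+q]*½≡q : ∀ q → (q + q) * ½ ≡ q
[q+q]*½≡q q = solve 1 (λ q → (q :+ q) :* con ½ := q) refl q
  where open ℚ-Solver

half-≤ : ∀ {p q} → p ≤ q + q → p * ½ ≤ q
half-≤ {p} {q} p≤2q = subst (p * ½ ≤_) ([q+q]*½≡q q) (*-monoʳ-≤-nonNeg ½ p≤2q)

≤-half : ∀ {p q} → q + q ≤ p → q ≤ p * ½
≤-half {p} {q} 2q≤p = subst (_≤ p * ½) ([q+q]*½≡q q) (*-monoʳ-≤-nonNeg ½ 2q≤p)

removed-share : ∀ ε {d R} → R ≤ ε * (d + R) → (1ℚ - ε) * R ≤ ε * d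
removed-share ε {d} {R} R≤ε[d+R] = subst₂ _≤_
  (solve 2 (λ ε R → R :- ε :* R := (con 1ℚ :- ε) :* R) refl ε R)
  (solve 3 (λ ε d R → ε :* (d :+ R) :- ε :* R := ε :* d) refl ε d R)
  (+-monoˡ-≤ (- (ε * R)) R≤ε[d+R])
  where open ℚ-Solver

-- ε may be negative; then 0 ≤ εd forces d ≤ 0 ≤ e.
*-monoˡ-≤-if-0≤* : ∀ ε {d e} → 0ℚ ≤ ε * d → 0ℚ ≤ e → e ≤ d → ε * e ≤ ε * d
*-monoˡ-≤-if-0≤* ε {d} {e} 0≤εd 0≤e e≤d with 0ℚ ≤? ε
... | yes 0≤ε = *-monoˡ-≤-nonNeg ε {{nonNegative 0≤ε}} e≤d
... | no  0≰ε = *-monoˡ-≤-nonPos ε {{nonPositive (<⇒≤ ε<0)}} (≤-trans d≤0 0≤e)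
  where
  ε<0 = ≰⇒> 0≰ε
  d≤0 : d ≤ 0ℚ
  d≤0 = *-cancelˡ-≤-neg ε {{negative ε<0}} (subst (_≤ ε * d) (sym (*-zeroʳ ε)) 0≤εd)

-- (1 - ε)(1 + 8ε)·d/2 = d/2 + 2εd + 4εd(3/8 - ε), and εd ≥ 0 because (1 - ε)R₁ ≤ εd.
near-common-upper : ∀ ε {d e R₁ R₂ I J} → ε < + 3 / 8 → 0ℚ ≤ e → e ≤ d → 0ℚ ≤ R₁ →
  R₁ ≤ ε * (d + R₁) → R₂ ≤ ε * (e + R₂) →
  (1ℚ - ε) * I ≤ d * ½ → J ≤ I + R₁ + R₂ → J ≤ (1ℚ + ℕ→ℚ 8 * ε) * (d * ½)
near-common-upper ε {d} {e} {R₁} {R₂} {I} {J} ε<3/8 0≤e e≤d 0≤R₁ R₁≤ R₂≤ I≤ J≤ =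
  *-cancelˡ-≤-pos (1ℚ - ε) {{positive 0<1-ε}} (begin
    (1ℚ - ε) * J
      ≤⟨ *-monoˡ-≤-nonNeg (1ℚ - ε) {{nonNegative (<⇒≤ 0<1-ε)}} J≤ ⟩
    (1ℚ - ε) * (I + R₁ + R₂)
      ≡⟨ solve 4 (λ c I R₁ R₂ → c :* (I :+ R₁ :+ R₂) := c :* I :+ c :* R₁ :+ c :* R₂)
           refl (1ℚ - ε) I R₁ R₂ ⟩
    (1ℚ - ε) * I + (1ℚ - ε) * R₁ + (1ℚ - ε) * R₂
      ≤⟨ +-mono-≤ (+-mono-≤ I≤ share₁) (removed-share ε R₂≤) ⟩
    d * ½ + ε * d + ε * e
      ≤⟨ +-monoʳ-≤ (d * ½ + ε * d) (*-monoˡ-≤-if-0≤* ε 0≤εd 0≤e e≤d) ⟩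
    d * ½ + ε * d + ε * d
      ≤⟨ subst (_≤ d * ½ + ε * d + ε * d + slack) (+-identityʳ _)
           (+-monoʳ-≤ (d * ½ + ε * d + ε * d) 0≤slack) ⟩
    d * ½ + ε * d + ε * d + slack
      ≡⟨ solve 2 (λ ε d → d :* con ½ :+ ε :* d :+ ε :* d
                          :+ con (ℕ→ℚ 4) :* (ε :* d :* (con (+ 3 / 8) :- ε))
                          := (con 1ℚ :- ε) :* ((con 1ℚ :+ con (ℕ→ℚ 8) :* ε) :* (d :* con ½)))
           refl ε d ⟩
    (1ℚ - ε) * ((1ℚ + ℕ→ℚ 8 * ε) * (d * ½)) ∎)
  where
  open ≤-Reasoning
  open ℚ-Solver
  0<3/8-ε : 0ℚ < + 3 / 8 - ε
  0<3/8-ε = p<q⇒0<q-p ε<3/8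
  0<1-ε : 0ℚ < 1ℚ - ε
  0<1-ε = p<q⇒0<q-p (<-trans ε<3/8 (toWitness {a? = + 3 / 8 <? 1ℚ} tt))
  share₁ : (1ℚ - ε) * R₁ ≤ ε * d
  share₁ = removed-share ε R₁≤
  0≤εd : 0ℚ ≤ ε * d
  0≤εd = ≤-trans (nonNeg*nonNeg (<⇒≤ 0<1-ε) 0≤R₁) share₁
  slack : ℚ
  slack = ℕ→ℚ 4 * (ε * d * (+ 3 / 8 - ε))
  0≤slack : 0ℚ ≤ slack
  0≤slack = nonNeg*nonNeg (ℕ→ℚ-nonNeg 4) (nonNeg*nonNeg 0≤εd (<⇒≤ 0<3/8-ε))

common-comm : ∀ H u v → common H u v ≡ common H v u
common-comm H u v = count-cong (λ w → 𝔹.∧-comm (adj H u w) (adj H v w))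

candidate-common-bounds : ∀ {ε} H {u v} → deg H v ℕ.≤ deg H u → CandAdj ε H u v →
  (1ℚ - ℕ→ℚ 6 * ε) * (ℕ→ℚ (deg H u) * ½) ≤ ℕ→ℚ (common H u v)
  × (1ℚ - ε) * ℕ→ℚ (common H u v) ≤ ℕ→ℚ (deg H u) * ½
candidate-common-bounds H     _     (_ , inj₁ (_ , _ , bounds)) = bounds
candidate-common-bounds H {u} {v} dv≤du (_ , inj₂ (du≤dv , _ , bounds))
  rewrite ℕ.≤-antisym du≤dv dv≤du | common-comm H u v = bounds

module NearTensor {ε : ℚ} {G H : Graph} {ψ : Fin (n H) ⤖ VP G} (near : IsNear ε G H ψ) where
  open IsNear near

  to : Fin (n H) → VP G
  to = Bijection.to ψ

  kept : VP G → VP G → Bool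
  kept w x = adjP G w x ∧ not (rem w x)

  removed : Fin (n H) → ℕ
  removed u = countP G (rem (to u))

  private
    transport : (F : VP G → Bool) → count (F ∘ to) ≡ countP G F
    transport = count-transport G ψ

    common≡count-kept : ∀ u v → common H u v ≡ count (λ w → kept (to u) (to w) ∧ kept (to v) (to w))
    common≡count-kept u v = count-cong (λ w → cong₂ _∧_ (iso u w) (iso v w))

  degP≡deg+removed : ∀ u → degP G (to u) ≡ deg H u ℕ.+ removed u
  degP≡deg+removed u = begin
    degP G a
      ≡⟨ transport (adjP G a) ⟨
    count (λ w → adjP G a (to w))
      ≡⟨ count-+ (λ w → indicator-split (rem⊆E a (to w))) ⟩
    count (λ w → kept a (to w)) ℕ.+ count (λ w → rem a (to w))
      ≡⟨ cong₂ ℕ._+_ (sym (count-cong (iso u))) (transport (rem a)) ⟩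
    deg H u ℕ.+ removed u ∎
    where
    open ≡-Reasoning
    a = to u

  common≤commonP : ∀ u v → common H u v ℕ.≤ commonP G (to u) (to v)
  common≤commonP u v = begin
    common H u v
      ≡⟨ common≡count-kept u v ⟩
    count (λ w → kept a (to w) ∧ kept c (to w))
      ≤⟨ count-mono (λ w → indicator-kept-≤ (adjP G a (to w)) (rem a (to w))
                                             (adjP G c (to w)) (rem c (to w))) ⟩
    count (λ w → adjP G a (to w) ∧ adjP G c (to w))
      ≡⟨ transport (λ x → adjP G a x ∧ adjP G c x) ⟩
    commonP G a c ∎
    where
    open ℕ.≤-Reasoning
    a = to u
    c = to v

  commonP≤common+removed : ∀ u v →
    commonP G (to u) (to v) ℕ.≤ common H u v ℕ.+ removed u ℕ.+ removed v
  commonP≤common+removed u v = begin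
    commonP G a c
      ≡⟨ transport (λ x → adjP G a x ∧ adjP G c x) ⟨
    count (λ w → adjP G a (to w) ∧ adjP G c (to w))
      ≤⟨ count-≤-+ (λ w → indicator-≤-kept+removed (adjP G a (to w)) (rem a (to w))
                                                    (adjP G c (to w)) (rem c (to w))) ⟩
    count (λ w → kept a (to w) ∧ kept c (to w)) ℕ.+ count (λ w → rem a (to w) ∨ rem c (to w))
      ≤⟨ ℕ.+-mono-≤ (ℕ.≤-reflexive (sym (common≡count-kept u v)))
                    (count-≤-+ (λ w → indicator-∨ (rem a (to w)) (rem c (to w)))) ⟩
    common H u v ℕ.+ (count (rem a ∘ to) ℕ.+ count (rem c ∘ to))
      ≡⟨ cong (common H u v ℕ.+_) (cong₂ ℕ._+_ (transport (rem a)) (transport (rem c))) ⟩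
    common H u v ℕ.+ (removed u ℕ.+ removed v)
      ≡⟨ ℕ.+-assoc (common H u v) (removed u) (removed v) ⟨
    common H u v ℕ.+ removed u ℕ.+ removed v ∎
    where
    open ℕ.≤-Reasoning
    a = to u
    c = to v

  removed-bound : ∀ u → ℕ→ℚ (removed u) ≤ ε * (ℕ→ℚ (deg H u) + ℕ→ℚ (removed u))
  removed-bound u = subst (λ D → ℕ→ℚ (removed u) ≤ ε * D)
    (trans (cong ℕ→ℚ (degP≡deg+removed u)) (ℕ→ℚ-+ (deg H u) (removed u)))
    (rem-deg (to u))

  commonP-bounds : ε < + 3 / 8 → ∀ {u v} → CandAdj ε H u v → deg H v ℕ.≤ deg H u →
    (1ℚ - ℕ→ℚ 6 * ε) * (ℕ→ℚ (deg H u) * ½) ≤ ℕ→ℚ (commonP G (to u) (to v))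
    × ℕ→ℚ (commonP G (to u) (to v)) ≤ (1ℚ + ℕ→ℚ 8 * ε) * (ℕ→ℚ (deg H u) * ½)
  commonP-bounds ε<3/8 {u} {v} uv∈C dv≤du =
      ≤-trans I-lower (ℕ→ℚ-mono-≤ (common≤commonP u v))
    , near-common-upper ε ε<3/8 (ℕ→ℚ-nonNeg (deg H v)) (ℕ→ℚ-mono-≤ dv≤du)
        (ℕ→ℚ-nonNeg (removed u)) (removed-bound u) (removed-bound v) I-upper J≤I+R₁+R₂
    where
    I-lower = proj₁ (candidate-common-bounds {ε} H dv≤du uv∈C)
    I-upper = proj₂ (candidate-common-bounds {ε} H dv≤du uv∈C)
    J≤I+R₁+R₂ : ℕ→ℚ (commonP G (to u) (to v))
              ≤ ℕ→ℚ (common H u v) + ℕ→ℚ (removed u) + ℕ→ℚ (removed v)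
    J≤I+R₁+R₂ = subst (ℕ→ℚ (commonP G (to u) (to v)) ≤_)
      (trans (ℕ→ℚ-+ (common H u v ℕ.+ removed u) (removed v))
             (cong (_+ ℕ→ℚ (removed v)) (ℕ→ℚ-+ (common H u v) (removed u))))
      (ℕ→ℚ-mono-≤ (commonP≤common+removed u v))

divide-by-commonK3 : ∀ x y d (t t' : Fin 3) (C : ℕ) →
  x * (d * ½) ≤ ℕ→ℚ (commonK3 t t' ℕ.* C) → ℕ→ℚ (commonK3 t t' ℕ.* C) ≤ y * (d * ½) →
  (t ≡ t' × x * (d * (+ 1 / 4)) ≤ ℕ→ℚ C × ℕ→ℚ C ≤ y * (d * (+ 1 / 4)))
  ⊎ (t ≢ t' × x * (d * ½) ≤ ℕ→ℚ C × ℕ→ℚ C ≤ y * (d * ½))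
divide-by-commonK3 x y d t t' C lo hi with commonK3-cases t t'
... | inj₁ (t≡t' , k≡2) =
  inj₁ (t≡t' , subst (_≤ ℕ→ℚ C) (quarter x) (half-≤ (subst (_ ≤_) twice lo))
             , subst (ℕ→ℚ C ≤_) (quarter y) (≤-half (subst (_≤ _) twice hi)))
  where
  open ℚ-Solver
  twice : ℕ→ℚ (commonK3 t t' ℕ.* C) ≡ ℕ→ℚ C + ℕ→ℚ C
  twice = trans (cong (λ k → ℕ→ℚ (k ℕ.* C)) k≡2) (ℕ→ℚ-double C)
  quarter : ∀ z → z * (d * ½) * ½ ≡ z * (d * (+ 1 / 4))
  quarter z = solve 2 (λ z d → z :* (d :* con ½) :* con ½ := z :* (d :* con (+ 1 / 4))) refl z d
... | inj₂ (t≢t' , k≡1) = inj₂ (t≢t' , subst (_ ≤_) once lo , subst (_≤ _) once hi)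
  where
  once : ℕ→ℚ (commonK3 t t' ℕ.* C) ≡ ℕ→ℚ C
  once = cong ℕ→ℚ (trans (cong (ℕ._* C) k≡1) (ℕ.*-identityˡ C))

proposition3p2 : (ε : ℚ) → ε < (+ 1) / 40 →
    (G H : Graph) (ψ : Fin (n H) ⤖ VP G) → IsNear ε G H ψ →
    (u v : Fin (n H)) → CandAdj ε H u v → deg H v ℕ.≤ deg H u →
    let t₁ = proj₁ (Bijection.to ψ u)
        g₁ = proj₂ (Bijection.to ψ u)
        t₂ = proj₁ (Bijection.to ψ v)
        g₂ = proj₂ (Bijection.to ψ v)
        d  = ℕ→ℚ (deg H u)
        I  = ℕ→ℚ (common G g₁ g₂)
    in (t₁ ≡ t₂ × (1ℚ - ℕ→ℚ 6 * ε) * (d * ((+ 1) / 4)) ≤ I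
                × I ≤ (1ℚ + ℕ→ℚ 8 * ε) * (d * ((+ 1) / 4)))
       ⊎ (t₁ ≢ t₂ × (1ℚ - ℕ→ℚ 6 * ε) * (d * ((+ 1) / 2)) ≤ I
                × I ≤ (1ℚ + ℕ→ℚ 8 * ε) * (d * ((+ 1) / 2)))
proposition3p2 ε ε<1/40 G H ψ near u v uv∈C dv≤du =
  divide-by-commonK3 (1ℚ - ℕ→ℚ 6 * ε) (1ℚ + ℕ→ℚ 8 * ε) (ℕ→ℚ (deg H u))
    t₁ t₂ (common G g₁ g₂)
    (subst (_ ≤_) tensor (proj₁ bounds)) (subst (_≤ _) tensor (proj₂ bounds))
  where
  open NearTensor near using (to; commonP-bounds)
  t₁ = proj₁ (to u)
  g₁ = proj₂ (to u)
  t₂ = proj₁ (to v)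
  g₂ = proj₂ (to v)
  bounds = commonP-bounds (<-trans ε<1/40 (toWitness {a? = + 1 / 40 <? + 3 / 8} tt))
                          uv∈C dv≤du
  tensor : ℕ→ℚ (commonP G (to u) (to v)) ≡ ℕ→ℚ (commonK3 t₁ t₂ ℕ.* common G g₁ g₂)
  tensor = cong ℕ→ℚ (commonP-tensor G t₁ t₂ g₁ g₂)
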